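{- Let $R$ be a discrete valuation ring with uniformizer $\pi$ and valuation $v$, let $f(x)=x^2-ax-b\in R[x]$ be irreducible, let $\theta$ be a root of $f$ and $\mathcal{O}=R[\theta]$. Fix $r\in R$ and put $T=b-r(r+a)$. Consider the ideals of $\mathcal{O}$ of the form $J_n=R\pi^n\oplus R(r+\theta)$, $n\ge 0$. Then every such ideal is equivalent to $J_n$ for some integer $n$ with $0\le n\le\min\{v(2r+a),\tfrac12 v(T)\}$, and the ideals $J_n$ with $0\le n\le \min\{v(2r+a),\tfrac12 v(T)\}$ are pairwise inequivalent.
   Context: Two ideals $J_1,J_2$ of $\mathcal{O}$ are equivalent if $\alpha_1J_1=\alpha_2J_2$ for some nonzero $\alpha_1,\alpha_2\in\mathcal{O}$. $v(0)=+\infty$. No assumption on the characteristic of $K$ is made. -}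

module Defs where

open import Level using (Level; _⊔_) renaming (suc to lsuc)
open import Data.Nat using (ℕ; zero; suc) renaming (_+_ to _+ℕ_; _*_ to _*ℕ_)
open import Data.List using (List; []; _∷_)
open import Data.Product using (Σ; ∃; _×_; _,_)
open import Data.Sum using (_⊎_)
open import Relation.Nullary using (¬_)
open import Algebra.Bundles using (CommutativeRing)

module RingNotions {c ℓ : Level} (R : CommutativeRing c ℓ) where
  open CommutativeRing R

  _∣_ : Carrier → Carrier → Set (c ⊔ ℓ)
  x ∣ y = ∃ λ q → (q * x) ≈ y

  IsUnit : Carrier → Set (c ⊔ ℓ)
  IsUnit x = ∃ λ y → (x * y) ≈ 1#

  _^_ : Carrier → ℕ → Carrier
  x ^ zero    = 1#
  x ^ (suc n) = x * (x ^ n)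

  -- The polynomial ring R[x]: coefficient lists (constant term first),
  -- compared coefficientwise (so trailing zeros are irrelevant).

  Poly : Set c
  Poly = List Carrier

  coeff : Poly → ℕ → Carrier
  coeff []       _       = 0#
  coeff (c ∷ p)  zero    = c
  coeff (c ∷ p)  (suc i) = coeff p i

  _≈ₚ_ : Poly → Poly → Set ℓ
  p ≈ₚ q = ∀ i → coeff p i ≈ coeff q i

  _+ₚ_ : Poly → Poly → Poly
  []      +ₚ q       = q
  (c ∷ p) +ₚ []      = c ∷ p
  (c ∷ p) +ₚ (d ∷ q) = (c + d) ∷ (p +ₚ q)

  scaleₚ : Carrier → Poly → Poly
  scaleₚ c []      = []
  scaleₚ c (d ∷ q) = (c * d) ∷ scaleₚ c q

  _*ₚ_ : Poly → Poly → Poly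
  []      *ₚ q = []
  (c ∷ p) *ₚ q = scaleₚ c q +ₚ (0# ∷ (p *ₚ q))

  oneₚ : Poly
  oneₚ = 1# ∷ []

  IsUnitₚ : Poly → Set (c ⊔ ℓ)
  IsUnitₚ p = ∃ λ q → (p *ₚ q) ≈ₚ oneₚ

  Irreducibleₚ : Poly → Set (c ⊔ ℓ)
  Irreducibleₚ p =
    ¬ (p ≈ₚ []) × ¬ IsUnitₚ p ×
    (∀ g h → p ≈ₚ (g *ₚ h) → IsUnitₚ g ⊎ IsUnitₚ h)

  quadPoly : Carrier → Carrier → Poly
  quadPoly a b = (- b) ∷ (- a) ∷ 1# ∷ []

-- The valuation is
-- v(x) = the exponent n (v(0) = +∞); it satisfies  n ≤ v(x)  ⇔  π^n ∣ x
-- (also for x = 0), which is how inequalities "n ≤ v(x)" are expressed below.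

record DVR (c ℓ : Level) : Set (lsuc (c ⊔ ℓ)) where
  field
    R : CommutativeRing c ℓ
  open CommutativeRing R public
  open RingNotions R public
  field
    1≉0       : ¬ (1# ≈ 0#)
    noZeroDiv : ∀ x y → (x * y) ≈ 0# → (x ≈ 0#) ⊎ (y ≈ 0#)
    π         : Carrier
    π≉0       : ¬ (π ≈ 0#)
    π-nonunit : ¬ IsUnit π
    factor    : ∀ x → ¬ (x ≈ 0#) → ∃ λ (n : ℕ) → ∃ λ u → IsUnit u × (x ≈ (u * (π ^ n)))

  _≤v_ : ℕ → Carrier → Set (c ⊔ ℓ)
  n ≤v x = (π ^ n) ∣ x

-- The order 𝒪 = R[θ], θ a root of x² - a x - b (f irreducible, so
-- 𝒪 ≅ R[x]/(f) is free over R with basis 1, θ).  The element p + qθ is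
-- represented by the pair (p , q); θ² = aθ + b.

module Order {c ℓ : Level} (D : DVR c ℓ) (a b : DVR.Carrier D) where
  open DVR D

  𝒪 : Set c
  𝒪 = Carrier × Carrier

  _≈ₒ_ : 𝒪 → 𝒪 → Set ℓ
  (p , q) ≈ₒ (s , t) = (p ≈ s) × (q ≈ t)

  _+ₒ_ : 𝒪 → 𝒪 → 𝒪
  (p , q) +ₒ (s , t) = (p + s , q + t)

  -- (p + qθ)(s + tθ) = (ps + qt b) + (pt + qs + qt a)θ
  _*ₒ_ : 𝒪 → 𝒪 → 𝒪
  (p , q) *ₒ (s , t) = ((p * s) + ((q * t) * b) , ((p * t) + (q * s)) + ((q * t) * a))

  0ₒ : 𝒪
  0ₒ = (0# , 0#)

  ι : Carrier → 𝒪
  ι x = (x , 0#)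

  θ : 𝒪
  θ = (0# , 1#)

  Subset𝒪 : Set (lsuc (c ⊔ ℓ))
  Subset𝒪 = 𝒪 → Set (c ⊔ ℓ)

  IsIdeal : Subset𝒪 → Set (c ⊔ ℓ)
  IsIdeal J =
    (∀ x y → x ≈ₒ y → J x → J y) ×
    J 0ₒ ×
    (∀ x y → J x → J y → J (x +ₒ y)) ×
    (∀ z x → J x → J (z *ₒ x))

  scaled : 𝒪 → Subset𝒪 → Subset𝒪
  scaled α J z = ∃ λ j → J j × (z ≈ₒ (α *ₒ j))

  Equivalent : Subset𝒪 → Subset𝒪 → Set (c ⊔ ℓ)
  Equivalent J₁ J₂ = ∃ λ α₁ → ∃ λ α₂ →
    ¬ (α₁ ≈ₒ 0ₒ) × ¬ (α₂ ≈ₒ 0ₒ) ×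
    (∀ z → (scaled α₁ J₁ z → scaled α₂ J₂ z) × (scaled α₂ J₂ z → scaled α₁ J₁ z))

  J : Carrier → ℕ → Subset𝒪
  J r n z = ∃ λ x → ∃ λ y → z ≈ₒ ((ι (x * (π ^ n))) +ₒ (ι y *ₒ (ι r +ₒ θ)))

{-# OPTIONS --safe #-}
module Submission where

-- Put s = r + θ. Then s² = e s + T with e = 2r + a and T = b − r(r + a), and
-- J_n = Rπⁿ + Rs. Uniqueness: if n ≤ v(e) and 2n ≤ v(T), then s/πⁿ maps J_n into
-- itself; this property passes to every equivalent ideal because 𝒪 is a domain
-- (a root of f in the fraction field of the valuation ring R would lie in R),
-- while J_m has it only when n ≤ m. Existence: J_n being an ideal forces πⁿ ∣ T,
-- so n ≤ N = v(T); put t = N − n. For γ = μπⁿ + s one has πᵏJ_n = γJ_k as soon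
-- as a 2×2 determinant is a unit: μ = 0 gives J_n ~ J_t when t ≤ n and πᵗ ∣ e,
-- and μ = 1 gives J_n ~ J_k for k = v(e) < min(n, t).

open import Defs
open import Level using (Level)
open import Data.Nat using (ℕ; _≤_) renaming (_*_ to _*ℕ_)
open import Data.Product using (Σ; ∃; _×_; _,_)
open import Relation.Binary.PropositionalEquality using (_≡_)

open import Level using (_⊔_)
open import Algebra.Bundles using (CommutativeRing)
open import Algebra.Solver.Ring.AlmostCommutativeRing
  using (_-Raw-AlmostCommutative⟶_; fromCommutativeRing)
open import Data.Empty using (⊥; ⊥-elim)
open import Data.Integer as ℤ using (ℤ; +_; -[1+_]; _⊖_)
import Data.Integer.Properties as ℤ
open import Data.List using (List; []; _∷_; length)
open import Data.Maybe using (map)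
open import Data.Nat as ℕ using (zero; suc)
import Data.Nat.Properties as ℕ
open import Data.Product using (proj₁; proj₂)
open import Data.Sum using (_⊎_; inj₁; inj₂; [_,_]′; reduce)
open import Function using (_∘_; id)
open import Relation.Binary.Bundles using (Setoid)
import Relation.Binary.PropositionalEquality as ≡
open import Relation.Nullary using (¬_; Dec; yes; no)
open import Relation.Nullary.Decidable using (¬¬-excluded-middle; map′; dec⇒maybe)

last-satisfying : ∀ {p} (P : ℕ → Set p) {M} → P 0 → (∀ k → suc k ≤ M → Dec (P (suc k))) →
                  P M ⊎ ∃ λ k → k ℕ.< M × P k × ¬ P (suc k)
last-satisfying P {zero}  P0 P? = inj₁ P0
last-satisfying P {suc M} P0 P? with last-satisfying P {M} P0 (λ k k<M → P? k (ℕ.m≤n⇒m≤1+n k<M))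
... | inj₂ (k , k<M , Pk , ¬Pk+1) = inj₂ (k , ℕ.m<n⇒m<1+n k<M , Pk , ¬Pk+1)
... | inj₁ PM with P? M ℕ.≤-refl
...   | yes PM+1 = inj₁ PM+1
...   | no  ¬PM+1 = inj₂ (M , ℕ.n<1+n M , PM , ¬PM+1)

-- The ring solver needs coefficients with decidable equality; ℤ maps into every
-- commutative ring.
module IntegerCoefficients {ℓ₁ ℓ₂ : Level} (R : CommutativeRing ℓ₁ ℓ₂) where
  open CommutativeRing R
  open import Algebra.Properties.Ring ring
    using (-0#≈0#; -‿involutive; -‿+-comm; -‿distribˡ-*; -‿distribʳ-*)
  open import Algebra.Properties.Semiring.Mult.TCOptimised semiring using (1+×; ×-homo-+; ×1-homo-*)
    renaming (_×_ to _·_)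
  open import Relation.Binary.Reasoning.Setoid setoid

  ⟦_⟧ℤ : ℤ → Carrier
  ⟦ + n ⟧ℤ      = n · 1#
  ⟦ -[1+ n ] ⟧ℤ = - (suc n · 1#)

  -‿homo : ∀ i → ⟦ ℤ.- i ⟧ℤ ≈ - ⟦ i ⟧ℤ
  -‿homo (+ zero)  = sym -0#≈0#
  -‿homo (+ suc n) = refl
  -‿homo -[1+ n ]  = sym (-‿involutive _)

  private
    x-y≈[1+x]-[1+y] : ∀ x y → x - y ≈ (1# + x) - (1# + y)
    x-y≈[1+x]-[1+y] x y = begin
      x - y                     ≈⟨ +-congʳ (+-identityˡ x) ⟨
      (0# + x) - y              ≈⟨ +-congʳ (+-congʳ (-‿inverseʳ 1#)) ⟨
      ((1# - 1#) + x) - y       ≈⟨ +-congʳ (+-assoc 1# (- 1#) x) ⟩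
      (1# + (- 1# + x)) - y     ≈⟨ +-congʳ (+-congˡ (+-comm (- 1#) x)) ⟩
      (1# + (x - 1#)) - y       ≈⟨ +-congʳ (+-assoc 1# x (- 1#)) ⟨
      ((1# + x) - 1#) - y       ≈⟨ +-assoc (1# + x) (- 1#) (- y) ⟩
      (1# + x) + (- 1# - y)     ≈⟨ +-congˡ (-‿+-comm 1# y) ⟩
      (1# + x) - (1# + y)       ∎

  ⊖-homo : ∀ m n → ⟦ m ⊖ n ⟧ℤ ≈ m · 1# - n · 1#
  ⊖-homo m       zero    = sym (trans (+-congˡ -0#≈0#) (+-identityʳ _))
  ⊖-homo zero    (suc n) = sym (+-identityˡ _)
  ⊖-homo (suc m) (suc n) = begin
    ⟦ suc m ⊖ suc n ⟧ℤ              ≡⟨ ≡.cong ⟦_⟧ℤ (ℤ.[1+m]⊖[1+n]≡m⊖n m n) ⟩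
    ⟦ m ⊖ n ⟧ℤ                      ≈⟨ ⊖-homo m n ⟩
    m · 1# - n · 1#                 ≈⟨ x-y≈[1+x]-[1+y] _ _ ⟩
    (1# + m · 1#) - (1# + n · 1#)   ≈⟨ +-cong (1+× m 1#) (-‿cong (1+× n 1#)) ⟨
    suc m · 1# - suc n · 1#         ∎

  +-homo : ∀ i j → ⟦ i ℤ.+ j ⟧ℤ ≈ ⟦ i ⟧ℤ + ⟦ j ⟧ℤ
  +-homo (+ m)    (+ n)    = ×-homo-+ 1# m n
  +-homo (+ m)    -[1+ n ] = ⊖-homo m (suc n)
  +-homo -[1+ m ] (+ n)    = trans (⊖-homo n (suc m)) (+-comm _ _)
  +-homo -[1+ m ] -[1+ n ] = begin
    - (suc (suc (m ℕ.+ n)) · 1#)        ≡⟨ ≡.cong (λ k → - (suc k · 1#)) (ℕ.+-suc m n) ⟨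
    - ((suc m ℕ.+ suc n) · 1#)          ≈⟨ -‿cong (×-homo-+ 1# (suc m) (suc n)) ⟩
    - (suc m · 1# + suc n · 1#)         ≈⟨ -‿+-comm _ _ ⟨
    - (suc m · 1#) - (suc n · 1#)       ∎

  *-homo-+ : ∀ i n → ⟦ i ℤ.* + n ⟧ℤ ≈ ⟦ i ⟧ℤ * ⟦ + n ⟧ℤ
  *-homo-+ (+ m) n = begin
    ⟦ + m ℤ.* + n ⟧ℤ     ≡⟨ ≡.cong ⟦_⟧ℤ (ℤ.pos-* m n) ⟨
    (m ℕ.* n) · 1#       ≈⟨ ×1-homo-* m n ⟩
    (m · 1#) * (n · 1#)  ∎
  *-homo-+ -[1+ m ] n = begin
    ⟦ ℤ.- (+ suc m) ℤ.* + n ⟧ℤ   ≡⟨ ≡.cong ⟦_⟧ℤ (ℤ.neg-distribˡ-* (+ suc m) (+ n)) ⟨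
    ⟦ ℤ.- (+ suc m ℤ.* + n) ⟧ℤ   ≈⟨ -‿homo (+ suc m ℤ.* + n) ⟩
    - ⟦ + suc m ℤ.* + n ⟧ℤ       ≈⟨ -‿cong (*-homo-+ (+ suc m) n) ⟩
    - (⟦ + suc m ⟧ℤ * ⟦ + n ⟧ℤ)  ≈⟨ -‿distribˡ-* _ _ ⟩
    ⟦ -[1+ m ] ⟧ℤ * ⟦ + n ⟧ℤ     ∎

  *-homo : ∀ i j → ⟦ i ℤ.* j ⟧ℤ ≈ ⟦ i ⟧ℤ * ⟦ j ⟧ℤ
  *-homo i (+ n)    = *-homo-+ i n
  *-homo i -[1+ n ] = begin
    ⟦ i ℤ.* ℤ.- (+ suc n) ⟧ℤ   ≡⟨ ≡.cong ⟦_⟧ℤ (ℤ.neg-distribʳ-* i (+ suc n)) ⟨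
    ⟦ ℤ.- (i ℤ.* + suc n) ⟧ℤ   ≈⟨ -‿homo (i ℤ.* + suc n) ⟩
    - ⟦ i ℤ.* + suc n ⟧ℤ       ≈⟨ -‿cong (*-homo-+ i (suc n)) ⟩
    - (⟦ i ⟧ℤ * ⟦ + suc n ⟧ℤ)  ≈⟨ -‿distribʳ-* _ _ ⟩
    ⟦ i ⟧ℤ * ⟦ -[1+ n ] ⟧ℤ     ∎

  ℤ-morphism : ℤ.+-*-rawRing -Raw-AlmostCommutative⟶ fromCommutativeRing R
  ℤ-morphism = record
    { ⟦_⟧    = ⟦_⟧ℤ
    ; +-homo = +-homo
    ; *-homo = *-homo
    ; -‿homo = -‿homo
    ; 0-homo = refl
    ; 1-homo = refl
    }

  open import Algebra.Solver.Ring ℤ.+-*-rawRing (fromCommutativeRing R) ℤ-morphism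
    (λ i j → map (λ i≡j → reflexive (≡.cong ⟦_⟧ℤ i≡j)) (dec⇒maybe (i ℤ.≟ j))) public

module CommutativeRingProperties {ℓ₁ ℓ₂ : Level} (R : CommutativeRing ℓ₁ ℓ₂) where
  open CommutativeRing R
  open RingNotions R
  open IntegerCoefficients R using (solve; _:=_; _:+_; _:*_; _:-_; :-_; con)
  open import Algebra.Properties.Ring ring using (x∙y⁻¹≈ε⇒x≈y; x≈y⇒x∙y⁻¹≈ε)
  open import Relation.Binary.Reasoning.Setoid setoid

  private
    scaled-difference≈0 : ∀ k {x y} → x ≈ y → k * (x - y) ≈ 0#
    scaled-difference≈0 k x≈y = trans (*-congˡ (x≈y⇒x∙y⁻¹≈ε x≈y)) (zeroʳ k)

  combination₁ : ∀ {x y a b} k → x - y ≈ k * (a - b) → a ≈ b → x ≈ y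
  combination₁ k eq a≈b = x∙y⁻¹≈ε⇒x≈y _ _ (trans eq (scaled-difference≈0 k a≈b))

  combination₂ : ∀ {x y a b a′ b′} k k′ → x - y ≈ k * (a - b) + k′ * (a′ - b′) →
                 a ≈ b → a′ ≈ b′ → x ≈ y
  combination₂ k k′ eq a≈b a′≈b′ = x∙y⁻¹≈ε⇒x≈y _ _ (begin
    _                            ≈⟨ eq ⟩
    k * (_ - _) + k′ * (_ - _)   ≈⟨ +-cong (scaled-difference≈0 k a≈b) (scaled-difference≈0 k′ a′≈b′) ⟩
    0# + 0#                      ≈⟨ +-identityʳ 0# ⟩
    0#                           ∎)

  combination₃ : ∀ {x y a b a′ b′ a″ b″} k k′ k″ →
                 x - y ≈ k * (a - b) + k′ * (a′ - b′) + k″ * (a″ - b″) →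
                 a ≈ b → a′ ≈ b′ → a″ ≈ b″ → x ≈ y
  combination₃ k k′ k″ eq a≈b a′≈b′ a″≈b″ = x∙y⁻¹≈ε⇒x≈y _ _ (begin
    _                                         ≈⟨ eq ⟩
    k * (_ - _) + k′ * (_ - _) + k″ * (_ - _)
      ≈⟨ +-cong (+-cong (scaled-difference≈0 k a≈b) (scaled-difference≈0 k′ a′≈b′)) (scaled-difference≈0 k″ a″≈b″) ⟩
    0# + 0# + 0#                              ≈⟨ trans (+-identityʳ _) (+-identityʳ 0#) ⟩
    0#                                        ∎)

  ^-+ : ∀ x m n → x ^ (m ℕ.+ n) ≈ x ^ m * x ^ n
  ^-+ x zero    n = sym (*-identityˡ _)
  ^-+ x (suc m) n = trans (*-congˡ (^-+ x m n)) (sym (*-assoc _ _ _))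

  ^-split : ∀ x {m n} → m ≤ n → x ^ n ≈ x ^ m * x ^ (n ℕ.∸ m)
  ^-split x {m} {n} m≤n = begin
    x ^ n                    ≡⟨ ≡.cong (x ^_) (ℕ.m+[n∸m]≡n m≤n) ⟨
    x ^ (m ℕ.+ (n ℕ.∸ m))    ≈⟨ ^-+ x m (n ℕ.∸ m) ⟩
    x ^ m * x ^ (n ℕ.∸ m)    ∎

  ^-double : ∀ x n → x ^ (2 *ℕ n) ≈ x ^ n * x ^ n
  ^-double x n = begin
    x ^ (n ℕ.+ (n ℕ.+ 0))    ≈⟨ ^-+ x n (n ℕ.+ 0) ⟩
    x ^ n * x ^ (n ℕ.+ 0)    ≡⟨ ≡.cong (λ k → x ^ n * x ^ k) (ℕ.+-identityʳ n) ⟩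
    x ^ n * x ^ n            ∎

  ∣-respʳ-≈ : ∀ {x y z} → y ≈ z → x ∣ y → x ∣ z
  ∣-respʳ-≈ y≈z (q , qx≈y) = q , trans qx≈y y≈z

  ∣-respˡ-≈ : ∀ {x y z} → x ≈ y → x ∣ z → y ∣ z
  ∣-respˡ-≈ x≈y (q , qx≈z) = q , trans (*-congˡ (sym x≈y)) qx≈z

  IsUnit-resp-≈ : ∀ {x y} → x ≈ y → IsUnit x → IsUnit y
  IsUnit-resp-≈ x≈y (x⁻¹ , xx⁻¹≈1) = x⁻¹ , trans (*-congʳ (sym x≈y)) xx⁻¹≈1

  -‿IsUnit : ∀ {x} → IsUnit x → IsUnit (- x)
  -‿IsUnit {x} (x⁻¹ , xx⁻¹≈1) =
    - x⁻¹ , trans (solve 2 (λ x y → (:- x) :* (:- y) := x :* y) refl x x⁻¹) xx⁻¹≈1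

  cramer : ∀ {a b c d} → IsUnit (a * d - b * c) → ∀ u v →
           ∃ λ x → ∃ λ y → (a * x + b * y ≈ u) × (c * x + d * y ≈ v)
  cramer {a} {b} {c} {d} (δ⁻¹ , δδ⁻¹≈1) u v = x , y , first-row , second-row
    where
    x = (d * u - b * v) * δ⁻¹
    y = (a * v - c * u) * δ⁻¹
    first-row : a * x + b * y ≈ u
    first-row = combination₁ u
      (solve 7 (λ a b c d u v i → a :* ((d :* u :- b :* v) :* i) :+ b :* ((a :* v :- c :* u) :* i) :- u
                                  := u :* ((a :* d :- b :* c) :* i :- con (+ 1)))
             refl a b c d u v δ⁻¹)
      δδ⁻¹≈1
    second-row : c * x + d * y ≈ v
    second-row = combination₁ v
      (solve 7 (λ a b c d u v i → c :* ((d :* u :- b :* v) :* i) :+ d :* ((a :* v :- c :* u) :* i) :- v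
                                  := v :* ((a :* d :- b :* c) :* i :- con (+ 1)))
             refl a b c d u v δ⁻¹)
      δδ⁻¹≈1

module PolynomialProperties {ℓ₁ ℓ₂ : Level} (R : CommutativeRing ℓ₁ ℓ₂) where
  open CommutativeRing R
  open RingNotions R
  open CommutativeRingProperties R
  open IntegerCoefficients R using (solve; _:=_; _:+_; _:*_; _:-_; :-_; con)
  open import Relation.Binary.Reasoning.Setoid setoid

  coeff-+ₚ : ∀ p q i → coeff (p +ₚ q) i ≈ coeff p i + coeff q i
  coeff-+ₚ []      q       i       = sym (+-identityˡ _)
  coeff-+ₚ (x ∷ p) []      i       = sym (+-identityʳ _)
  coeff-+ₚ (x ∷ p) (y ∷ q) zero    = refl
  coeff-+ₚ (x ∷ p) (y ∷ q) (suc i) = coeff-+ₚ p q i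

  coeff-scaleₚ : ∀ k q i → coeff (scaleₚ k q) i ≈ k * coeff q i
  coeff-scaleₚ k []      i       = sym (zeroʳ k)
  coeff-scaleₚ k (y ∷ q) zero    = refl
  coeff-scaleₚ k (y ∷ q) (suc i) = coeff-scaleₚ k q i

  coeff-∷-*ₚ : ∀ k p q i → coeff ((k ∷ p) *ₚ q) i ≈ k * coeff q i + coeff (0# ∷ (p *ₚ q)) i
  coeff-∷-*ₚ k p q i = trans (coeff-+ₚ (scaleₚ k q) (0# ∷ (p *ₚ q)) i) (+-congʳ (coeff-scaleₚ k q i))

  coeff-length : ∀ q j → coeff q (length q ℕ.+ j) ≈ 0#
  coeff-length []      j = refl
  coeff-length (y ∷ q) j = coeff-length q j

  coeff-0∷[] : ∀ i → coeff (0# ∷ []) i ≈ 0#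
  coeff-0∷[] zero    = refl
  coeff-0∷[] (suc i) = refl

  monic-linear-nonunit : ¬ 1# ≈ 0# → ∀ k → ¬ IsUnitₚ (k ∷ 1# ∷ [])
  monic-linear-nonunit 1≉0 k (q , [k+x]q≈1) = 1≉0 (begin
    1#                                ≈⟨ [k+x]q≈1 0 ⟨
    coeff ((k ∷ 1# ∷ []) *ₚ q) 0      ≈⟨ coeff-∷-*ₚ k (1# ∷ []) q 0 ⟩
    k * coeff q 0 + 0#                ≈⟨ +-identityʳ _ ⟩
    k * coeff q 0                     ≈⟨ *-congˡ (vanish (length q) 0 (coeff-length q 0)) ⟩
    k * 0#                            ≈⟨ zeroʳ k ⟩
    0#                                ∎)
    where
    coeff-[k+x]q : ∀ i → coeff ((k ∷ 1# ∷ []) *ₚ q) (suc i) ≈ k * coeff q (suc i) + coeff q i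
    coeff-[k+x]q i = begin
      coeff ((k ∷ 1# ∷ []) *ₚ q) (suc i)                   ≈⟨ coeff-∷-*ₚ k (1# ∷ []) q (suc i) ⟩
      k * coeff q (suc i) + coeff ((1# ∷ []) *ₚ q) i       ≈⟨ +-congˡ (coeff-∷-*ₚ 1# [] q i) ⟩
      k * coeff q (suc i) + (1# * coeff q i + coeff (0# ∷ []) i)
        ≈⟨ +-congˡ (+-cong (*-identityˡ _) (coeff-0∷[] i)) ⟩
      k * coeff q (suc i) + (coeff q i + 0#)               ≈⟨ +-congˡ (+-identityʳ _) ⟩
      k * coeff q (suc i) + coeff q i                      ∎
    vanish-step : ∀ i → coeff q (suc i) ≈ 0# → coeff q i ≈ 0#
    vanish-step i qᵢ₊₁≈0 = begin
      coeff q i                            ≈⟨ +-identityˡ _ ⟨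
      0# + coeff q i                       ≈⟨ +-congʳ (trans (*-congˡ qᵢ₊₁≈0) (zeroʳ k)) ⟨
      k * coeff q (suc i) + coeff q i      ≈⟨ coeff-[k+x]q i ⟨
      coeff ((k ∷ 1# ∷ []) *ₚ q) (suc i)   ≈⟨ [k+x]q≈1 (suc i) ⟩
      0#                                   ∎
    vanish : ∀ j i → coeff q (j ℕ.+ i) ≈ 0# → coeff q i ≈ 0#
    vanish zero    i qᵢ≈0   = qᵢ≈0
    vanish (suc j) i qⱼ₊ᵢ≈0 = vanish j i (vanish-step (j ℕ.+ i) qⱼ₊ᵢ≈0)

  Rootless : Carrier → Carrier → Set (ℓ₁ ⊔ ℓ₂)
  Rootless a b = ∀ x → ¬ (x * x ≈ a * x + b)

  irreducible⇒rootless : ¬ 1# ≈ 0# → ∀ {a b} → Irreducibleₚ (quadPoly a b) → Rootless a b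
  irreducible⇒rootless 1≉0 {a} {b} (_ , _ , factors) x root =
    [ monic-linear-nonunit 1≉0 (- x) , monic-linear-nonunit 1≉0 (x - a) ]′
      (factors ((- x) ∷ 1# ∷ []) ((x - a) ∷ 1# ∷ []) factorisation)
    where
    factorisation : quadPoly a b ≈ₚ (((- x) ∷ 1# ∷ []) *ₚ ((x - a) ∷ 1# ∷ []))
    factorisation zero = combination₁ 1#
      (solve 3 (λ x a b → (:- b) :- ((:- x) :* (x :- a) :+ con (+ 0))
                          := con (+ 1) :* (x :* x :- (a :* x :+ b))) refl x a b)
      root
    factorisation (suc zero) =
      solve 2 (λ x a → :- a := (:- x) :* con (+ 1) :+ (con (+ 1) :* (x :- a) :+ con (+ 0))) refl x a
    factorisation (suc (suc zero))    = sym (*-identityˡ 1#)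
    factorisation (suc (suc (suc i))) = refl

module DVRProperties {ℓ₁ ℓ₂ : Level} (D : DVR ℓ₁ ℓ₂) where
  open DVR D
  open CommutativeRingProperties R
  open IntegerCoefficients R using (solve; _:=_; _:+_; _:*_; _:-_; :-_; con)
  open import Algebra.Properties.Ring ring using (x∙y⁻¹≈ε⇒x≈y; x≈y⇒x∙y⁻¹≈ε; x[y-z]≈xy-xz)
  open import Relation.Binary.Reasoning.Setoid setoid

  *-cancelˡ : ∀ {k x y} → ¬ k ≈ 0# → k * x ≈ k * y → x ≈ y
  *-cancelˡ {k} {x} {y} k≉0 kx≈ky =
    [ (λ k≈0 → ⊥-elim (k≉0 k≈0)) , x∙y⁻¹≈ε⇒x≈y x y ]′
      (noZeroDiv k (x - y) (trans (x[y-z]≈xy-xz k x y) (x≈y⇒x∙y⁻¹≈ε kx≈ky)))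

  *-≉0 : ∀ {x y} → ¬ x ≈ 0# → ¬ y ≈ 0# → ¬ x * y ≈ 0#
  *-≉0 x≉0 y≉0 xy≈0 = [ x≉0 , y≉0 ]′ (noZeroDiv _ _ xy≈0)

  x*x≈0⇒x≈0 : ∀ {x} → x * x ≈ 0# → x ≈ 0#
  x*x≈0⇒x≈0 xx≈0 = reduce (noZeroDiv _ _ xx≈0)

  π^≉0 : ∀ n → ¬ π ^ n ≈ 0#
  π^≉0 zero    = 1≉0
  π^≉0 (suc n) = *-≉0 π≉0 (π^≉0 n)

  π∤unit : ∀ {u} → IsUnit u → ¬ π ∣ u
  π∤unit {u} (u⁻¹ , uu⁻¹≈1) (q , qπ≈u) =
    π-nonunit (q * u⁻¹ , trans (solve 3 (λ p q v → p :* (q :* v) := (q :* p) :* v) refl π q u⁻¹)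
                               (trans (*-congʳ qπ≈u) uu⁻¹≈1))

  ≤⇒π^∣ : ∀ {m n} x → m ≤ n → (π ^ m) ∣ (x * π ^ n)
  ≤⇒π^∣ {m} {n} x m≤n = x * π ^ (n ℕ.∸ m) , (begin
    x * π ^ (n ℕ.∸ m) * π ^ m     ≈⟨ solve 3 (λ x d m → x :* d :* m := x :* (m :* d)) refl x (π ^ (n ℕ.∸ m)) (π ^ m) ⟩
    x * (π ^ m * π ^ (n ℕ.∸ m))   ≈⟨ *-congˡ (^-split π m≤n) ⟨
    x * π ^ n                     ∎)

  π^∣unit*π^⇒≤ : ∀ {u m n} → IsUnit u → (π ^ n) ∣ (u * π ^ m) → n ≤ m
  π^∣unit*π^⇒≤ {u} {m} {n} u-unit (q , qπⁿ≈uπᵐ) = ℕ.≮⇒≥ m≮n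
    where
    m≮n : ¬ m ℕ.< n
    m≮n m<n = π∤unit u-unit (q * π ^ (n ℕ.∸ suc m) , *-cancelˡ (π^≉0 m) (begin
      π ^ m * (q * π ^ (n ℕ.∸ suc m) * π)
        ≈⟨ solve 4 (λ m q d p → m :* (q :* d :* p) := q :* (p :* m :* d)) refl (π ^ m) q (π ^ (n ℕ.∸ suc m)) π ⟩
      q * (π ^ suc m * π ^ (n ℕ.∸ suc m))   ≈⟨ *-congˡ (^-split π m<n) ⟨
      q * π ^ n                             ≈⟨ qπⁿ≈uπᵐ ⟩
      u * π ^ m                             ≈⟨ *-comm u (π ^ m) ⟩
      π ^ m * u                             ∎))

  π^∣? : ∀ n {x} → ¬ x ≈ 0# → Dec ((π ^ n) ∣ x)
  π^∣? n {x} x≉0 with factor x x≉0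
  ... | m , u , u-unit , x≈uπᵐ with n ℕ.≤? m
  ...   | yes n≤m = yes (∣-respʳ-≈ (sym x≈uπᵐ) (≤⇒π^∣ u n≤m))
  ...   | no  n≰m = no (λ πⁿ∣x → n≰m (π^∣unit*π^⇒≤ u-unit (∣-respʳ-≈ x≈uπᵐ πⁿ∣x)))

  π∤⇒unit : ∀ {x} → ¬ π ∣ x → IsUnit x
  π∤⇒unit {x} π∤x with factor x (λ x≈0 → π∤x (0# , trans (zeroˡ π) (sym x≈0)))
  ... | zero  , u , u-unit , x≈u1  = IsUnit-resp-≈ (sym (trans x≈u1 (*-identityʳ u))) u-unit
  ... | suc m , u , _      , x≈uππᵐ = ⊥-elim (π∤x (u * π ^ m , (begin
    u * π ^ m * π     ≈⟨ solve 3 (λ u m p → u :* m :* p := u :* (p :* m)) refl u (π ^ m) π ⟩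
    u * π ^ suc m     ≈⟨ x≈uππᵐ ⟨
    x                 ∎)))

  unit+π*-unit : ∀ {u} x → IsUnit u → IsUnit (u + π * x)
  unit+π*-unit {u} x u-unit = π∤⇒unit λ { (q , qπ≈u+πx) → π∤unit u-unit (q - x , (begin
    (q - x) * π         ≈⟨ solve 3 (λ q x p → (q :- x) :* p := q :* p :- p :* x) refl q x π ⟩
    q * π - π * x       ≈⟨ +-congʳ qπ≈u+πx ⟩
    u + π * x - π * x   ≈⟨ solve 2 (λ u y → u :+ y :- y := u) refl u (π * x) ⟩
    u                   ∎)) }

  unit*π^∣unit*π^ : ∀ {u i j} w → IsUnit u → i ≤ j → (u * π ^ i) ∣ (w * π ^ j)
  unit*π^∣unit*π^ {u} {i} {j} w (u⁻¹ , uu⁻¹≈1) i≤j = w * u⁻¹ * π ^ (j ℕ.∸ i) , (begin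
    w * u⁻¹ * π ^ (j ℕ.∸ i) * (u * π ^ i)
      ≈⟨ solve 5 (λ w v d u i → w :* v :* d :* (u :* i) := w :* (u :* v) :* (i :* d)) refl w u⁻¹ (π ^ (j ℕ.∸ i)) u (π ^ i) ⟩
    w * (u * u⁻¹) * (π ^ i * π ^ (j ℕ.∸ i))  ≈⟨ *-cong (*-congˡ uu⁻¹≈1) (sym (^-split π i≤j)) ⟩
    w * 1# * π ^ j                           ≈⟨ *-congʳ (*-identityʳ w) ⟩
    w * π ^ j                                ∎)

  ∣-total : ∀ x y → ¬ ¬ (x ∣ y ⊎ y ∣ x)
  ∣-total x y goal =
    ¬¬-excluded-middle λ x≟0 → ¬¬-excluded-middle λ y≟0 → goal (by-cases x≟0 y≟0)
    where
    0∣ : ∀ {z} → z ≈ 0# → ∀ w → w ∣ z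
    0∣ z≈0 w = 0# , trans (zeroˡ w) (sym z≈0)
    by-cases : Dec (x ≈ 0#) → Dec (y ≈ 0#) → x ∣ y ⊎ y ∣ x
    by-cases (yes x≈0) _         = inj₂ (0∣ x≈0 y)
    by-cases (no _)    (yes y≈0) = inj₁ (0∣ y≈0 x)
    by-cases (no x≉0)  (no y≉0) with factor x x≉0 | factor y y≉0
    ... | i , u , u-unit , x≈uπⁱ | j , w , w-unit , y≈wπʲ with i ℕ.≤? j
    ...   | yes i≤j = inj₁ (∣-respˡ-≈ (sym x≈uπⁱ) (∣-respʳ-≈ (sym y≈wπʲ) (unit*π^∣unit*π^ w u-unit i≤j)))
    ...   | no  i≰j =
      inj₂ (∣-respˡ-≈ (sym y≈wπʲ) (∣-respʳ-≈ (sym x≈uπⁱ) (unit*π^∣unit*π^ u w-unit (ℕ.<⇒≤ (ℕ.≰⇒> i≰j)))))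

module OrderProperties {ℓ₁ ℓ₂ : Level} (D : DVR ℓ₁ ℓ₂) (a b : DVR.Carrier D)
  (rootless : PolynomialProperties.Rootless (DVR.R D) a b) where
  open DVR D
  open Order D a b
  open CommutativeRingProperties R
  open DVRProperties D
  open IntegerCoefficients R using (solve; _:=_; _:+_; _:*_; _:-_; :-_; con)
  open import Algebra.Properties.Ring ring using (x∙y⁻¹≈ε⇒x≈y)

  -- −p/q would be a root of x² − ax − b, and R is a valuation ring, so it would lie in R.
  no-projective-root : ∀ {p q} → ¬ (p ≈ 0# × q ≈ 0#) → ¬ (p * p + a * p * q ≈ b * q * q)
  no-projective-root {p} {q} nontrivial norm≈0 = ∣-total q p [ from-q∣p , (λ p∣q → from-q∣p (p∣q⇒q∣p p∣q)) ]′
    where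
    from-q∣p : q ∣ p → ⊥
    from-q∣p (x , xq≈p) =
      [ (λ qq≈0 → nontrivial (p≈0 (x*x≈0⇒x≈0 qq≈0) , x*x≈0⇒x≈0 qq≈0))
      , (λ root → rootless (- x) (x∙y⁻¹≈ε⇒x≈y _ _ root)) ]′
      (noZeroDiv (q * q) ((- x) * (- x) - (a * (- x) + b)) (combination₂ 1# (x * q + p + a * q)
        (solve 5 (λ p q x a b → q :* q :* ((:- x) :* (:- x) :- (a :* (:- x) :+ b)) :- con (+ 0)
                                := con (+ 1) :* (p :* p :+ a :* p :* q :- b :* q :* q) :+ (x :* q :+ p :+ a :* q) :* (x :* q :- p))
               refl p q x a b)
        norm≈0 xq≈p))
      where
      p≈0 : q ≈ 0# → p ≈ 0#
      p≈0 q≈0 = trans (sym xq≈p) (trans (*-congˡ q≈0) (zeroʳ x))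
    p∣q⇒q∣p : p ∣ q → q ∣ p
    p∣q⇒q∣p (y , yp≈q) =
      [ (λ pp≈0 → ⊥-elim (nontrivial (x*x≈0⇒x≈0 pp≈0 , q≈0 (x*x≈0⇒x≈0 pp≈0))))
      , (λ unit → b * y - a , combination₂ (- (b * y - a)) (- p)
          (solve 5 (λ p q y a b → (b :* y :- a) :* q :- p
                                  := (:- (b :* y :- a)) :* (y :* p :- q) :+ (:- p) :* ((con (+ 1) :- y :* (b :* y :- a)) :- con (+ 0)))
                 refl p q y a b)
          yp≈q unit) ]′
      (noZeroDiv (p * p) (1# - y * (b * y - a)) (combination₂ 1# (a * p - b * (y * p + q))
        (solve 5 (λ p q y a b → p :* p :* (con (+ 1) :- y :* (b :* y :- a)) :- con (+ 0)
                                := con (+ 1) :* (p :* p :+ a :* p :* q :- b :* q :* q) :+ (a :* p :- b :* (y :* p :+ q)) :* (y :* p :- q))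
               refl p q y a b)
        norm≈0 yp≈q))
      where
      q≈0 : p ≈ 0# → q ≈ 0#
      q≈0 p≈0 = trans (sym yp≈q) (trans (*-congˡ p≈0) (zeroʳ y))

  𝒪-setoid : Setoid ℓ₁ ℓ₂
  𝒪-setoid = record
    { Carrier       = 𝒪
    ; _≈_           = _≈ₒ_
    ; isEquivalence = record
      { refl  = refl , refl
      ; sym   = λ (x₁≈y₁ , x₂≈y₂) → sym x₁≈y₁ , sym x₂≈y₂
      ; trans = λ (x₁≈y₁ , x₂≈y₂) (y₁≈z₁ , y₂≈z₂) → trans x₁≈y₁ y₁≈z₁ , trans x₂≈y₂ y₂≈z₂
      }
    }

  open Setoid 𝒪-setoid public using () renaming (refl to ≈ₒ-refl; sym to ≈ₒ-sym; trans to ≈ₒ-trans)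

  *ₒ-cong : ∀ {x x′ y y′} → x ≈ₒ x′ → y ≈ₒ y′ → (x *ₒ y) ≈ₒ (x′ *ₒ y′)
  *ₒ-cong (x₁≈ , x₂≈) (y₁≈ , y₂≈) =
    +-cong (*-cong x₁≈ y₁≈) (*-congʳ (*-cong x₂≈ y₂≈)) ,
    +-cong (+-cong (*-cong x₁≈ y₂≈) (*-cong x₂≈ y₁≈)) (*-congʳ (*-cong x₂≈ y₂≈))

  *ₒ-congˡ : ∀ {x y y′} → y ≈ₒ y′ → (x *ₒ y) ≈ₒ (x *ₒ y′)
  *ₒ-congˡ = *ₒ-cong ≈ₒ-refl

  *ₒ-swap : ∀ x y z → (x *ₒ (y *ₒ z)) ≈ₒ (y *ₒ (x *ₒ z))
  *ₒ-swap (x₁ , x₂) (y₁ , y₂) (z₁ , z₂) =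
    solve 8 (λ x₁ x₂ y₁ y₂ z₁ z₂ a b →
      x₁ :* (y₁ :* z₁ :+ y₂ :* z₂ :* b) :+ x₂ :* ((y₁ :* z₂ :+ y₂ :* z₁) :+ y₂ :* z₂ :* a) :* b
      := y₁ :* (x₁ :* z₁ :+ x₂ :* z₂ :* b) :+ y₂ :* ((x₁ :* z₂ :+ x₂ :* z₁) :+ x₂ :* z₂ :* a) :* b)
      refl x₁ x₂ y₁ y₂ z₁ z₂ a b ,
    solve 8 (λ x₁ x₂ y₁ y₂ z₁ z₂ a b →
      (x₁ :* ((y₁ :* z₂ :+ y₂ :* z₁) :+ y₂ :* z₂ :* a) :+ x₂ :* (y₁ :* z₁ :+ y₂ :* z₂ :* b))
        :+ x₂ :* ((y₁ :* z₂ :+ y₂ :* z₁) :+ y₂ :* z₂ :* a) :* a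
      := (y₁ :* ((x₁ :* z₂ :+ x₂ :* z₁) :+ x₂ :* z₂ :* a) :+ y₂ :* (x₁ :* z₁ :+ x₂ :* z₂ :* b))
        :+ y₂ :* ((x₁ :* z₂ :+ x₂ :* z₁) :+ x₂ :* z₂ :* a) :* a)
      refl x₁ x₂ y₁ y₂ z₁ z₂ a b

  conj : 𝒪 → 𝒪
  conj (p , q) = p + q * a , - q

  norm : 𝒪 → Carrier
  norm (p , q) = p * p + a * p * q - b * q * q

  conj-*ₒ : ∀ α x → (conj α *ₒ (α *ₒ x)) ≈ₒ (norm α * proj₁ x , norm α * proj₂ x)
  conj-*ₒ (p , q) (x₁ , x₂) =
    solve 6 (λ p q x₁ x₂ a b →
      (p :+ q :* a) :* (p :* x₁ :+ q :* x₂ :* b) :+ (:- q) :* ((p :* x₂ :+ q :* x₁) :+ q :* x₂ :* a) :* b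
      := (p :* p :+ a :* p :* q :- b :* q :* q) :* x₁)
      refl p q x₁ x₂ a b ,
    solve 6 (λ p q x₁ x₂ a b →
      ((p :+ q :* a) :* ((p :* x₂ :+ q :* x₁) :+ q :* x₂ :* a) :+ (:- q) :* (p :* x₁ :+ q :* x₂ :* b))
        :+ (:- q) :* ((p :* x₂ :+ q :* x₁) :+ q :* x₂ :* a) :* a
      := (p :* p :+ a :* p :* q :- b :* q :* q) :* x₂)
      refl p q x₁ x₂ a b

  norm-≉0 : ∀ {α} → ¬ α ≈ₒ 0ₒ → ¬ norm α ≈ 0#
  norm-≉0 α≉0 norm≈0 = no-projective-root α≉0 (x∙y⁻¹≈ε⇒x≈y _ _ norm≈0)

  *ₒ-cancelˡ : ∀ {α x y} → ¬ α ≈ₒ 0ₒ → (α *ₒ x) ≈ₒ (α *ₒ y) → x ≈ₒ y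
  *ₒ-cancelˡ {α} {x} {y} α≉0 αx≈αy = *-cancelˡ (norm-≉0 α≉0) (proj₁ Nx≈Ny) , *-cancelˡ (norm-≉0 α≉0) (proj₂ Nx≈Ny)
    where
    Nx≈Ny : (norm α * proj₁ x , norm α * proj₂ x) ≈ₒ (norm α * proj₁ y , norm α * proj₂ y)
    Nx≈Ny = ≈ₒ-trans (≈ₒ-sym (conj-*ₒ α x)) (≈ₒ-trans (*ₒ-congˡ αx≈αy) (conj-*ₒ α y))

  _⊆_ : Subset𝒪 → Subset𝒪 → Set (ℓ₁ ⊔ ℓ₂)
  A ⊆ B = ∀ z → A z → B z

  scaled-resp-≈ : ∀ {α α′ J′} → α ≈ₒ α′ → scaled α J′ ⊆ scaled α′ J′
  scaled-resp-≈ α≈α′ z (j , j∈J , z≈αj) = j , j∈J , ≈ₒ-trans z≈αj (*ₒ-cong α≈α′ ≈ₒ-refl)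

  Equivalent-sym : ∀ {J₁ J₂} → Equivalent J₁ J₂ → Equivalent J₂ J₁
  Equivalent-sym (α₁ , α₂ , α₁≉0 , α₂≉0 , α₁J₁≐α₂J₂) =
    α₂ , α₁ , α₂≉0 , α₁≉0 , λ z → proj₂ (α₁J₁≐α₂J₂ z) , proj₁ (α₁J₁≐α₂J₂ z)

  Equivalent-refl : ∀ {J′} → Equivalent J′ J′
  Equivalent-refl = ι 1# , ι 1# , 1≉0 ∘ proj₁ , 1≉0 ∘ proj₁ , λ _ → id , id

  scaled-⊆-transfer : ∀ {J₁ J₂ σ β} → Equivalent J₁ J₂ → scaled σ J₂ ⊆ scaled β J₂ → scaled σ J₁ ⊆ scaled β J₁
  scaled-⊆-transfer {σ = σ} {β} (α₁ , α₂ , α₁≉0 , _ , α₁J₁≐α₂J₂) σJ₂⊆βJ₂ z (j₁ , j₁∈J₁ , z≈σj₁)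
    with proj₁ (α₁J₁≐α₂J₂ _) (j₁ , j₁∈J₁ , ≈ₒ-refl)
  ... | j₂ , j₂∈J₂ , α₁j₁≈α₂j₂ with σJ₂⊆βJ₂ _ (j₂ , j₂∈J₂ , ≈ₒ-refl)
  ... | j₂′ , j₂′∈J₂ , σj₂≈βj₂′ with proj₂ (α₁J₁≐α₂J₂ _) (j₂′ , j₂′∈J₂ , ≈ₒ-refl)
  ... | j₁′ , j₁′∈J₁ , α₂j₂′≈α₁j₁′ = j₁′ , j₁′∈J₁ , ≈ₒ-trans z≈σj₁ (*ₒ-cancelˡ α₁≉0 (begin
    α₁ *ₒ (σ *ₒ j₁)    ≈⟨ *ₒ-swap α₁ σ j₁ ⟩
    σ *ₒ (α₁ *ₒ j₁)    ≈⟨ *ₒ-congˡ α₁j₁≈α₂j₂ ⟩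
    σ *ₒ (α₂ *ₒ j₂)    ≈⟨ *ₒ-swap σ α₂ j₂ ⟩
    α₂ *ₒ (σ *ₒ j₂)    ≈⟨ *ₒ-congˡ σj₂≈βj₂′ ⟩
    α₂ *ₒ (β *ₒ j₂′)   ≈⟨ *ₒ-swap α₂ β j₂′ ⟩
    β *ₒ (α₂ *ₒ j₂′)   ≈⟨ *ₒ-congˡ α₂j₂′≈α₁j₁′ ⟩
    β *ₒ (α₁ *ₒ j₁′)   ≈⟨ *ₒ-swap β α₁ j₁′ ⟩
    α₁ *ₒ (β *ₒ j₁′)   ∎))
    where open import Relation.Binary.Reasoning.Setoid 𝒪-setoid

module Classification {ℓ₁ ℓ₂ : Level} (D : DVR ℓ₁ ℓ₂) (a b r : DVR.Carrier D)
  (rootless : PolynomialProperties.Rootless (DVR.R D) a b) where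
  open DVR D
  open Order D a b
  open CommutativeRingProperties R
  open DVRProperties D
  open OrderProperties D a b rootless
  open IntegerCoefficients R using (solve; _:=_; _:+_; _:*_; _:-_; :-_; con)

  e : Carrier
  e = (r + r) + a

  T : Carrier
  T = b - (r * (r + a))

  -- ⟪ x , y ⟫ is x + y s for s = r + θ, and s² = e s + T.
  ⟪_,_⟫ : Carrier → Carrier → 𝒪
  ⟪ x , y ⟫ = x + y * r , y

  ⟪⟫-cong : ∀ {x x′ y y′} → x ≈ x′ → y ≈ y′ → ⟪ x , y ⟫ ≈ₒ ⟪ x′ , y′ ⟫
  ⟪⟫-cong x≈x′ y≈y′ = +-cong x≈x′ (*-congʳ y≈y′) , y≈y′

  ⟪⟫-injective : ∀ {x x′ y y′} → ⟪ x , y ⟫ ≈ₒ ⟪ x′ , y′ ⟫ → x ≈ x′ × y ≈ y′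
  ⟪⟫-injective (x+yr≈x′+y′r , y≈y′) = +-cancelʳ _ _ _ (trans x+yr≈x′+y′r (+-congˡ (*-congʳ (sym y≈y′)))) , y≈y′
    where open import Algebra.Properties.Ring ring using (+-cancelʳ)

  ⟪⟫-*ₒ : ∀ x₁ y₁ x₂ y₂ →
          (⟪ x₁ , y₁ ⟫ *ₒ ⟪ x₂ , y₂ ⟫) ≈ₒ ⟪ x₁ * x₂ + y₁ * y₂ * T , x₁ * y₂ + x₂ * y₁ + y₁ * y₂ * e ⟫
  ⟪⟫-*ₒ x₁ y₁ x₂ y₂ =
    solve 7 (λ x₁ y₁ x₂ y₂ r a b →
      (x₁ :+ y₁ :* r) :* (x₂ :+ y₂ :* r) :+ y₁ :* y₂ :* b
      := x₁ :* x₂ :+ y₁ :* y₂ :* (b :- r :* (r :+ a)) :+ (x₁ :* y₂ :+ x₂ :* y₁ :+ y₁ :* y₂ :* ((r :+ r) :+ a)) :* r)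
      refl x₁ y₁ x₂ y₂ r a b ,
    solve 7 (λ x₁ y₁ x₂ y₂ r a b →
      (x₁ :+ y₁ :* r) :* y₂ :+ y₁ :* (x₂ :+ y₂ :* r) :+ y₁ :* y₂ :* a
      := x₁ :* y₂ :+ x₂ :* y₁ :+ y₁ :* y₂ :* ((r :+ r) :+ a))
      refl x₁ y₁ x₂ y₂ r a b

  ⟪⟫-*ₒ-≈ : ∀ {x₁ y₁ x₂ y₂ x₁′ y₁′ x₂′ y₂′} →
            x₁ * x₂ + y₁ * y₂ * T ≈ x₁′ * x₂′ + y₁′ * y₂′ * T →
            x₁ * y₂ + x₂ * y₁ + y₁ * y₂ * e ≈ x₁′ * y₂′ + x₂′ * y₁′ + y₁′ * y₂′ * e →
            (⟪ x₁ , y₁ ⟫ *ₒ ⟪ x₂ , y₂ ⟫) ≈ₒ (⟪ x₁′ , y₁′ ⟫ *ₒ ⟪ x₂′ , y₂′ ⟫)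
  ⟪⟫-*ₒ-≈ {x₁} {y₁} {x₂} {y₂} {x₁′} {y₁′} {x₂′} {y₂′} first second =
    ≈ₒ-trans (⟪⟫-*ₒ x₁ y₁ x₂ y₂) (≈ₒ-trans (⟪⟫-cong first second) (≈ₒ-sym (⟪⟫-*ₒ x₁′ y₁′ x₂′ y₂′)))

  J-coordinates : ∀ x y → (ι x +ₒ (ι y *ₒ (ι r +ₒ θ))) ≈ₒ ⟪ x , y ⟫
  J-coordinates x y =
    solve 5 (λ x y r a b → x :+ (y :* (r :+ con (+ 0)) :+ con (+ 0) :* (con (+ 0) :+ con (+ 1)) :* b)
                           := x :+ y :* r) refl x y r a b ,
    solve 5 (λ x y r a b → con (+ 0) :+ ((y :* (con (+ 0) :+ con (+ 1)) :+ con (+ 0) :* (r :+ con (+ 0)))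
                                          :+ con (+ 0) :* (con (+ 0) :+ con (+ 1)) :* a)
                           := y) refl x y r a b

  J-elim : ∀ n {z} → J r n z → ∃ λ x → ∃ λ y → z ≈ₒ ⟪ x * π ^ n , y ⟫
  J-elim n (x , y , z≈) = x , y , ≈ₒ-trans z≈ (J-coordinates (x * π ^ n) y)

  J-intro : ∀ n x y → J r n ⟪ x * π ^ n , y ⟫
  J-intro n x y = x , y , ≈ₒ-sym (J-coordinates (x * π ^ n) y)

  scaled-J⊆scaled-J : ∀ {α β m n} →
    (∀ x y → ∃ λ x′ → ∃ λ y′ → (α *ₒ ⟪ x * π ^ m , y ⟫) ≈ₒ (β *ₒ ⟪ x′ * π ^ n , y′ ⟫)) →
    scaled α (J r m) ⊆ scaled β (J r n)
  scaled-J⊆scaled-J {α} {β} {m} {n} coordinates z (j , j∈J , z≈αj) with J-elim m j∈J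
  ... | x , y , j≈ with coordinates x y
  ... | x′ , y′ , αj≈βj′ =
    ⟪ x′ * π ^ n , y′ ⟫ , J-intro n x′ y′ , ≈ₒ-trans z≈αj (≈ₒ-trans (*ₒ-congˡ j≈) αj≈βj′)

  -- ⟪ μ * π ^ n , 1# ⟫ is γ = μπⁿ + s, and πᵏ (Xπⁿ + Ys) = γ (xπᵏ + ys) whenever (X, Y) is
  -- the image of (x, y) under the matrix [[μ, c], [1, μQ + e₁]].
  module _ {n k Q c e₁} (πⁿ≈πᵏQ : π ^ n ≈ π ^ k * Q) (T≈cπⁿπᵏ : T ≈ c * (π ^ n * π ^ k))
           (e≈e₁πᵏ : e ≈ e₁ * π ^ k) (μ : Carrier) where

    γ-relation : ∀ {X Y x y} → X ≈ μ * x + c * y → Y ≈ 1# * x + (μ * Q + e₁) * y →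
                 (⟪ π ^ k , 0# ⟫ *ₒ ⟪ X * π ^ n , Y ⟫) ≈ₒ (⟪ μ * π ^ n , 1# ⟫ *ₒ ⟪ x * π ^ k , y ⟫)
    γ-relation {X} {Y} {x} {y} X≈ Y≈ = ⟪⟫-*ₒ-≈
      (combination₂ (π ^ k * π ^ n) (- y)
        (solve 9 (λ P πⁿ X Y T μ x y c →
           P :* (X :* πⁿ) :+ con (+ 0) :* Y :* T :- (μ :* πⁿ :* (x :* P) :+ con (+ 1) :* y :* T)
           := P :* πⁿ :* (X :- (μ :* x :+ c :* y)) :+ (:- y) :* (T :- c :* (πⁿ :* P)))
           refl (π ^ k) (π ^ n) X Y T μ x y c)
        X≈ T≈cπⁿπᵏ)
      (combination₃ (π ^ k) (- (μ * y)) (- y)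
        (solve 10 (λ P πⁿ X Y e μ x y Q e₁ →
           P :* Y :+ X :* πⁿ :* con (+ 0) :+ con (+ 0) :* Y :* e :- (μ :* πⁿ :* y :+ x :* P :* con (+ 1) :+ con (+ 1) :* y :* e)
           := P :* (Y :- (con (+ 1) :* x :+ (μ :* Q :+ e₁) :* y)) :+ (:- (μ :* y)) :* (πⁿ :- P :* Q) :+ (:- y) :* (e :- e₁ :* P))
           refl (π ^ k) (π ^ n) X Y e μ x y Q e₁)
        Y≈ πⁿ≈πᵏQ e≈e₁πᵏ)

    γJₖ⊆πᵏJₙ : scaled ⟪ μ * π ^ n , 1# ⟫ (J r k) ⊆ scaled ⟪ π ^ k , 0# ⟫ (J r n)
    γJₖ⊆πᵏJₙ = scaled-J⊆scaled-J {m = k} {n} λ x y →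
      μ * x + c * y , 1# * x + (μ * Q + e₁) * y , ≈ₒ-sym (γ-relation refl refl)

    πᵏJₙ⊆γJₖ : IsUnit (μ * (μ * Q + e₁) - c * 1#) → scaled ⟪ π ^ k , 0# ⟫ (J r n) ⊆ scaled ⟪ μ * π ^ n , 1# ⟫ (J r k)
    πᵏJₙ⊆γJₖ det-unit = scaled-J⊆scaled-J {m = n} {k} λ X Y →
      let x , y , X≈ , Y≈ = cramer det-unit X Y in x , y , γ-relation (sym X≈) (sym Y≈)

    Jₙ~Jₖ : IsUnit (μ * (μ * Q + e₁) - c * 1#) → Equivalent (J r n) (J r k)
    Jₙ~Jₖ det-unit =
      ⟪ π ^ k , 0# ⟫ , ⟪ μ * π ^ n , 1# ⟫ , πᵏ≉0 , 1≉0 ∘ proj₂ ,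
      λ z → πᵏJₙ⊆γJₖ det-unit z , γJₖ⊆πᵏJₙ z
      where
      πᵏ≉0 : ¬ ⟪ π ^ k , 0# ⟫ ≈ₒ 0ₒ
      πᵏ≉0 (πᵏ+0r≈0 , _) = π^≉0 k (trans (sym (trans (+-congˡ (zeroˡ r)) (+-identityʳ _))) πᵏ+0r≈0)

  Bound : ℕ → Set (ℓ₁ ⊔ ℓ₂)
  Bound n = (n ≤v e) × ((2 *ℕ n) ≤v T)

  -- J′ is a module over R[s/πⁿ].
  Stable : ℕ → Subset𝒪 → Set (ℓ₁ ⊔ ℓ₂)
  Stable n J′ = scaled ⟪ 0# , 1# ⟫ J′ ⊆ scaled ⟪ π ^ n , 0# ⟫ J′

  bounded⇒stable : ∀ n → Bound n → Stable n (J r n)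
  bounded⇒stable n ((e₁ , e₁πⁿ≈e) , (c , cπ²ⁿ≈T)) z sz =
    γJₖ⊆πᵏJₙ {n} {n} (sym (*-identityʳ _)) T≈cπⁿπⁿ (sym e₁πⁿ≈e) 0# z
      (scaled-resp-≈ (⟪⟫-cong (sym (zeroˡ _)) refl) z sz)
    where
    T≈cπⁿπⁿ : T ≈ c * (π ^ n * π ^ n)
    T≈cπⁿπⁿ = trans (sym cπ²ⁿ≈T) (*-congˡ (^-double π n))

  stable⇒≤ : ∀ m n → Stable n (J r m) → n ≤ m
  stable⇒≤ m n stable with stable _ (⟪ 1# * π ^ m , 0# ⟫ , J-intro m 1# 0# , ≈ₒ-refl)
  ... | j , j∈J , sπᵐ≈πⁿj with J-elim m j∈J
  ... | x , y , j≈ = π^∣unit*π^⇒≤ (1# , *-identityˡ 1#) (y , combination₁ (- 1#)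
    (solve 5 (λ y πⁿ πᵐ x e → y :* πⁿ :- con (+ 1) :* πᵐ
       := (:- con (+ 1)) :* ((con (+ 0) :* con (+ 0) :+ con (+ 1) :* πᵐ :* con (+ 1) :+ con (+ 1) :* con (+ 0) :* e)
                            :- (πⁿ :* y :+ x :* πᵐ :* con (+ 0) :+ con (+ 0) :* y :* e)))
       refl y (π ^ n) (π ^ m) x e)
    (proj₂ (⟪⟫-injective
      (≈ₒ-trans (≈ₒ-sym (⟪⟫-*ₒ _ _ _ _)) (≈ₒ-trans sπᵐ≈πⁿj (≈ₒ-trans (*ₒ-congˡ j≈) (⟪⟫-*ₒ _ _ _ _)))))))

  bounded-equivalent⇒≡ : ∀ m n → Bound m → Bound n → Equivalent (J r m) (J r n) → m ≡ n
  bounded-equivalent⇒≡ m n Bm Bn Jₘ~Jₙ = ℕ.≤-antisym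
    (stable⇒≤ n m (scaled-⊆-transfer (Equivalent-sym Jₘ~Jₙ) (bounded⇒stable m Bm)))
    (stable⇒≤ m n (scaled-⊆-transfer Jₘ~Jₙ (bounded⇒stable n Bn)))

  T≉0 : ¬ T ≈ 0#
  T≉0 T≈0 = rootless (- r) (combination₁ (- 1#)
    (solve 3 (λ r a b → (:- r) :* (:- r) :- (a :* (:- r) :+ b)
                        := (:- con (+ 1)) :* ((b :- r :* (r :+ a)) :- con (+ 0))) refl r a b)
    T≈0)

  θ*ₒs : (θ *ₒ ⟪ 0# , 1# ⟫) ≈ₒ ⟪ T , e - r ⟫
  θ*ₒs =
    solve 3 (λ r a b → con (+ 0) :* (con (+ 0) :+ con (+ 1) :* r) :+ con (+ 1) :* con (+ 1) :* b
                       := b :- r :* (r :+ a) :+ ((r :+ r) :+ a :- r) :* r) refl r a b ,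
    solve 3 (λ r a b → con (+ 0) :* con (+ 1) :+ con (+ 1) :* (con (+ 0) :+ con (+ 1) :* r) :+ con (+ 1) :* con (+ 1) :* a
                       := (r :+ r) :+ a :- r) refl r a b

  ideal⇒πⁿ∣T : ∀ n → IsIdeal (J r n) → (π ^ n) ∣ T
  ideal⇒πⁿ∣T n (_ , _ , _ , closed-*) = x , sym (proj₁ (⟪⟫-injective (≈ₒ-trans (≈ₒ-sym θ*ₒs) θs≈⟪xπⁿ,y⟫)))
    where
    s∈J : J r n ⟪ 0# , 1# ⟫
    s∈J = 0# , 1# , ≈ₒ-trans (⟪⟫-cong (sym (zeroˡ (π ^ n))) refl) (≈ₒ-sym (J-coordinates (0# * π ^ n) 1#))
    θs∈J = J-elim n (closed-* θ ⟪ 0# , 1# ⟫ s∈J)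
    x = proj₁ θs∈J
    θs≈⟪xπⁿ,y⟫ : (θ *ₒ ⟪ 0# , 1# ⟫) ≈ₒ ⟪ x * π ^ n , proj₁ (proj₂ θs∈J) ⟫
    θs≈⟪xπⁿ,y⟫ = proj₂ (proj₂ θs∈J)

  -- Divisibility is decidable only for nonzero elements. Here z ≉ 0 since πᵏ − r is not a
  -- root, and πᵏ ∣ e ⇔ π²ᵏ ∣ z because π²ᵏ ∣ T.
  πᵏ∣e? : ∀ k → (π ^ (2 *ℕ k)) ∣ T → Dec ((π ^ k) ∣ e)
  πᵏ∣e? k (t , tπ²ᵏ≈T) = map′ from-z to-z (π^∣? (2 *ℕ k) z≉0)
    where
    P = π ^ k
    z = P * (P - e) - T
    π²ᵏ≈PP = ^-double π k
    z≉0 : ¬ z ≈ 0#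
    z≉0 z≈0 = rootless (P - r) (combination₁ 1#
      (solve 4 (λ P r a b → (P :- r) :* (P :- r) :- (a :* (P :- r) :+ b)
                            := con (+ 1) :* ((P :* (P :- ((r :+ r) :+ a)) :- (b :- r :* (r :+ a))) :- con (+ 0)))
             refl P r a b)
      z≈0)
    from-z : (π ^ (2 *ℕ k)) ∣ z → P ∣ e
    from-z (w , wπ²ᵏ≈z) = 1# - w - t , *-cancelˡ (π^≉0 k) (combination₃ (- 1#) (- 1#) (w + t)
      (solve 6 (λ P e T w t π²ᵏ → P :* ((con (+ 1) :- w :- t) :* P) :- P :* e
                 := (:- con (+ 1)) :* (w :* π²ᵏ :- (P :* (P :- e) :- T)) :+ (:- con (+ 1)) :* (t :* π²ᵏ :- T)
                    :+ (w :+ t) :* (π²ᵏ :- P :* P))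
             refl P e T w t (π ^ (2 *ℕ k)))
      wπ²ᵏ≈z tπ²ᵏ≈T π²ᵏ≈PP)
    to-z : P ∣ e → (π ^ (2 *ℕ k)) ∣ z
    to-z (q , qP≈e) = 1# - q - t , combination₃ (1# - q) (- P) (- 1#)
      (solve 6 (λ P e T q t π²ᵏ → (con (+ 1) :- q :- t) :* π²ᵏ :- (P :* (P :- e) :- T)
                 := (con (+ 1) :- q) :* (π²ᵏ :- P :* P) :+ (:- P) :* (q :* P :- e) :+ (:- con (+ 1)) :* (t :* π²ᵏ :- T))
             refl P e T q t (π ^ (2 *ℕ k)))
      π²ᵏ≈PP qP≈e tπ²ᵏ≈T

  Jₙ~Jₜ-via-s : ∀ {n t u} → IsUnit u → T ≈ u * (π ^ n * π ^ t) → t ≤ n → (π ^ t) ∣ e →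
                Equivalent (J r n) (J r t)
  Jₙ~Jₜ-via-s {n} {t} {u} u-unit T≈uπⁿπᵗ t≤n (e₁ , e₁πᵗ≈e) =
    Jₙ~Jₖ {n} {t} (^-split π t≤n) T≈uπⁿπᵗ (sym e₁πᵗ≈e) 0# (IsUnit-resp-≈ -u≈det (-‿IsUnit u-unit))
    where
    -u≈det : - u ≈ 0# * (0# * π ^ (n ℕ.∸ t) + e₁) - u * 1#
    -u≈det = solve 3 (λ u Q e₁ → :- u := con (+ 0) :* (con (+ 0) :* Q :+ e₁) :- u :* con (+ 1))
                     refl u (π ^ (n ℕ.∸ t)) e₁

  Jₙ~Jₖ-via-πⁿ+s : ∀ {n t u k} → T ≈ u * (π ^ n * π ^ t) → k ℕ.< n → k ℕ.< t →
                   (π ^ k) ∣ e → ¬ (π ^ suc k) ∣ e → Equivalent (J r n) (J r k)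
  Jₙ~Jₖ-via-πⁿ+s {n} {t} {u} {k} T≈uπⁿπᵗ k<n k<t (e₁ , e₁πᵏ≈e) πᵏ⁺¹∤e =
    Jₙ~Jₖ {n} {k} πⁿ≈πᵏQ T≈cπⁿπᵏ (sym e₁πᵏ≈e) 1# (IsUnit-resp-≈ e₁+πx≈det (unit+π*-unit x e₁-unit))
    where
    d = π ^ (n ℕ.∸ suc k)
    d′ = π ^ (t ℕ.∸ suc k)
    x = d - u * d′
    πⁿ≈πᵏQ : π ^ n ≈ π ^ k * (π * d)
    πⁿ≈πᵏQ = trans (^-split π k<n) (solve 3 (λ p πᵏ d → p :* πᵏ :* d := πᵏ :* (p :* d)) refl π (π ^ k) d)
    T≈cπⁿπᵏ : T ≈ π * (u * d′) * (π ^ n * π ^ k)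
    T≈cπⁿπᵏ = trans T≈uπⁿπᵗ (trans (*-congˡ (*-congˡ (^-split π k<t)))
      (solve 5 (λ u πⁿ p πᵏ d′ → u :* (πⁿ :* (p :* πᵏ :* d′)) := p :* (u :* d′) :* (πⁿ :* πᵏ))
               refl u (π ^ n) π (π ^ k) d′))
    e₁-unit : IsUnit e₁
    e₁-unit = π∤⇒unit λ (q , qπ≈e₁) →
      πᵏ⁺¹∤e (q , trans (sym (*-assoc q π (π ^ k))) (trans (*-congʳ qπ≈e₁) e₁πᵏ≈e))
    e₁+πx≈det : e₁ + π * x ≈ 1# * (1# * (π * d) + e₁) - π * (u * d′) * 1#
    e₁+πx≈det = solve 5 (λ e₁ p d u d′ → e₁ :+ p :* (d :- u :* d′)
                         := con (+ 1) :* (con (+ 1) :* (p :* d) :+ e₁) :- p :* (u :* d′) :* con (+ 1))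
                        refl e₁ π d u d′

  module _ {N u} (u-unit : IsUnit u) (T≈uπᴺ : T ≈ u * π ^ N) (n : ℕ) (ideal : IsIdeal (J r n)) where

    private
      n≤N : n ≤ N
      n≤N = π^∣unit*π^⇒≤ u-unit (∣-respʳ-≈ T≈uπᴺ (ideal⇒πⁿ∣T n ideal))

      t = N ℕ.∸ n

      T≈uπⁿπᵗ : T ≈ u * (π ^ n * π ^ t)
      T≈uπⁿπᵗ = trans T≈uπᴺ (*-congˡ (^-split π n≤N))

      π²ᵐ∣T : ∀ {m} → m ≤ n → m ≤ t → (π ^ (2 *ℕ m)) ∣ T
      π²ᵐ∣T {m} m≤n m≤t = ∣-respʳ-≈ (sym T≈uπᴺ) (≤⇒π^∣ u (ℕ.≤-trans
        (ℕ.+-mono-≤ m≤n (ℕ.≤-trans (ℕ.≤-reflexive (ℕ.+-identityʳ m)) m≤t))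
        (ℕ.≤-reflexive (ℕ.m+[n∸m]≡n n≤N))))

      representative-below : ∀ M → M ≤ n → M ≤ t → ((π ^ M) ∣ e → Equivalent (J r n) (J r M)) →
                             ∃ λ m → Bound m × Equivalent (J r n) (J r m)
      representative-below M M≤n M≤t Jₙ~Jᴹ =
        [ (λ πᴹ∣e → M , (πᴹ∣e , π²ᵐ∣T M≤n M≤t) , Jₙ~Jᴹ πᴹ∣e)
        , (λ (k , k<M , πᵏ∣e , πᵏ⁺¹∤e) →
             let k<n = ℕ.<-≤-trans k<M M≤n
                 k<t = ℕ.<-≤-trans k<M M≤t
             in k , (πᵏ∣e , π²ᵐ∣T (ℕ.<⇒≤ k<n) (ℕ.<⇒≤ k<t)) ,
                Jₙ~Jₖ-via-πⁿ+s T≈uπⁿπᵗ k<n k<t πᵏ∣e πᵏ⁺¹∤e) ]′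
        (last-satisfying (λ k → (π ^ k) ∣ e) (e , *-identityʳ e)
          λ k k<M → πᵏ∣e? (suc k) (π²ᵐ∣T (ℕ.≤-trans k<M M≤n) (ℕ.≤-trans k<M M≤t)))

    bounded-representative : ∃ λ m → Bound m × Equivalent (J r n) (J r m)
    bounded-representative =
      [ (λ n≤t → representative-below n ℕ.≤-refl n≤t (λ _ → Equivalent-refl))
      , (λ t≤n → representative-below t t≤n ℕ.≤-refl (Jₙ~Jₜ-via-s u-unit T≈uπⁿπᵗ t≤n)) ]′
      (ℕ.≤-total n t)

  existence : ∀ n → IsIdeal (J r n) → ∃ λ m → Bound m × Equivalent (J r n) (J r m)
  existence = let N , _ , u-unit , T≈uπᴺ = factor T T≉0 in bounded-representative {N} u-unit T≈uπᴺ

lemma15 : ∀ {c ℓ} (D : DVR c ℓ) (a b r : DVR.Carrier D) →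
          let open DVR D
              open Order D a b
              T = b - (r * (r + a))
              Bound : ℕ → Set _
              Bound n = (n ≤v ((r + r) + a)) × ((2 *ℕ n) ≤v T)
          in Irreducibleₚ (quadPoly a b) →
             (∀ n → IsIdeal (J r n) → ∃ λ m → Bound m × Equivalent (J r n) (J r m)) ×
             (∀ m n → Bound m → Bound n → Equivalent (J r m) (J r n) → m ≡ n)
lemma15 D a b r irreducible = existence , bounded-equivalent⇒≡
  where
  open DVR D using (R; 1≉0)
  open Classification D a b r (PolynomialProperties.irreducible⇒rootless R 1≉0 irreducible)
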